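{- Let $\mathfrak P$ be a predicate structure with states $\Omega$, modal worlds $W$ and class of sets $\mathcal W$, and let $\mathfrak P^{B}$ be its birelational collapse. Let $A(\vec X)$ be a formula whose free variables are among $\vec X=X_1,\dots,X_n$, and let $\vec V=V_1,\dots,V_n\in\mathcal W$. Then for all $a\in\Omega$ and $v\in W$: $(a,v)\models_{\mathfrak P^B}A(V_1^{B},\dots,V_n^{B})$ if and only if $a,v\models_{\mathfrak P}A(V_1,\dots,V_n)$.
   Context: Formulas: $A ::= P \mid X \mid A\to B \mid \Box A \mid \blacksquare A \mid \forall X A$ over propositional symbols $P\in\mathsf{Pr}$ and second-order variables $X$; $A[C/X]$ is capture-avoiding substitution. A predicate structure $\mathfrak P$ consists of: a set $\Omega$ of states with a partial order $\le$; a set $W$ of modal worlds; a set $\mathcal W\supseteq\mathsf{Pr}$ of (modal) sets; for each $V\in\mathcal W$ and $a\in\Omega$ a set $V^a\subseteq W$ with $a\le b\Rightarrow V^a\subseteq V^b$; for each $a\in\Omega$ a relation $R^a\subseteq W\times W$ with $a\le b\Rightarrow R^a\subseteq R^b$. Expanding the language by each $V\in\mathcal W$ as a propositional symbol, satisfaction for $a\in\Omega$, $v\in W$, closed $A$: $a,v\models P$ iff $v\in P^a$; $a,v\models A\to B$ iff for all $b\ge a$, $b,v\models A$ implies $b,v\models B$; $a,v\models\Box A$ iff for all $b\ge a$ and $w$ with $vR^bw$, $b,w\models A$; $a,v\models\blacksquare A$ iff for all $b\ge a$ and $u$ with $uR^bv$, $b,u\models A$; $a,v\models\forall XA$ iff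 for all $b\ge a$ and $V\in\mathcal W$, $b,v\models A[V/X]$. A birelational structure consists of worlds, a partial order $\le$, a class of upward-closed sets of worlds, an interpretation of each $P\in\mathsf{Pr}$ as one of these sets, and a relation $R$; satisfaction (expanding the language by each set $V$ as a symbol interpreted as $V$): $v\models P$ iff $v\in P$'s interpretation; $v\models A\to B$ iff for all $v'\ge v$, $v'\models A\Rightarrow v'\models B$; $v\models\Box A$ iff for all $v'\ge v$, $w'$ with $v'Rw'$, $w'\models A$; $v\models\blacksquare A$ iff for all $v'\ge v$, $u'$ with $u'Rv'$, $u'\models A$; $v\models\forall XA$ iff for all $v'\ge v$ and all sets $V$ of the structure, $v'\models A[V/X]$. The birelational collapse $\mathfrak P^B$ of $\mathfrak P$: worlds $\Omega\times W$; $(a,v)\le(b,w)$ iff $a\le b$ and $v=w$; sets are $V^B:=\{(a,v): v\in V^a\}$ for $V\in\mathcal W$; each $P\in\mathsf{Pr}$ is interpreted as $P^B$; $(a,v)R(b,w)$ iff $a=b$ and $vR^aw$. (This is a birelational structure.) -}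

module Defs where

open import Data.Nat using (ℕ; suc)
open import Data.Fin using (Fin; zero; suc)
open import Data.Product using (_×_; _,_; proj₁; proj₂)
open import Relation.Binary.Structures using (IsPartialOrder; IsPreorder)
open import Relation.Binary.PropositionalEquality
  using (_≡_; refl; sym; trans; cong; isEquivalence; subst)
open import Function.Definitions using (Injective)

-- Formulas of second-order bi-intuitionistic-style modal logic.
-- Second-order variables are de Bruijn indices: Formula Pr n has its
-- free variables among X_0 … X_{n-1}; ∀' binds variable zero.

data Formula (Pr : Set) : ℕ → Set where
  prop : ∀ {n} → Pr → Formula Pr n
  var  : ∀ {n} → Fin n → Formula Pr n
  _⇒_  : ∀ {n} → Formula Pr n → Formula Pr n → Formula Pr n
  □    : ∀ {n} → Formula Pr n → Formula Pr n
  ■    : ∀ {n} → Formula Pr n → Formula Pr n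
  ∀'   : ∀ {n} → Formula Pr (suc n) → Formula Pr n

_∷ᵥ_ : ∀ {S : Set} {n} → S → (Fin n → S) → Fin (suc n) → S
(V ∷ᵥ ρ) zero    = V
(V ∷ᵥ ρ) (suc i) = ρ i

record PredStruct (Pr : Set) : Set₁ where
  field
    Ω       : Set
    _≤_     : Ω → Ω → Set
    ≤-po    : IsPartialOrder _≡_ _≤_
    W       : Set
    𝒲       : Set
    ι       : Pr → 𝒲            -- Pr ⊆ 𝒲
    ι-inj   : Injective _≡_ _≡_ ι
    ext     : 𝒲 → Ω → W → Set    -- ext V a w  means  w ∈ V^a
    ext-mono : ∀ {V a b w} → a ≤ b → ext V a w → ext V b w
    R       : Ω → W → W → Set    -- R a v w  means  v R^a w
    R-mono  : ∀ {a b v w} → a ≤ b → R a v w → R b v w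

  sat : ∀ {n} → Ω → W → Formula Pr n → (Fin n → 𝒲) → Set
  sat a v (prop P) ρ = ext (ι P) a v
  sat a v (var i)  ρ = ext (ρ i) a v
  sat a v (A ⇒ B)  ρ = ∀ b → a ≤ b → sat b v A ρ → sat b v B ρ
  sat a v (□ A)    ρ = ∀ b w → a ≤ b → R b v w → sat b w A ρ
  sat a v (■ A)    ρ = ∀ b u → a ≤ b → R b u v → sat b u A ρ
  sat a v (∀' A)   ρ = ∀ b → a ≤ b → (V : 𝒲) → sat b v A (V ∷ᵥ ρ)

record BiStruct (Pr : Set) : Set₁ where
  field
    Wd      : Set
    _≤_     : Wd → Wd → Set
    ≤-po    : IsPartialOrder _≡_ _≤_
    Sets    : Set                      -- index set of the class of sets
    mem     : Sets → Wd → Set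
    mem-up  : ∀ {V v v'} → v ≤ v' → mem V v → mem V v'
    val     : Pr → Sets
    R       : Wd → Wd → Set

  sat : ∀ {n} → Wd → Formula Pr n → (Fin n → Sets) → Set
  sat v (prop P) ρ = mem (val P) v
  sat v (var i)  ρ = mem (ρ i) v
  sat v (A ⇒ B)  ρ = ∀ v' → v ≤ v' → sat v' A ρ → sat v' B ρ
  sat v (□ A)    ρ = ∀ v' w' → v ≤ v' → R v' w' → sat w' A ρ
  sat v (■ A)    ρ = ∀ v' u' → v ≤ v' → R u' v' → sat u' A ρ
  sat v (∀' A)   ρ = ∀ v' → v ≤ v' → (V : Sets) → sat v' A (V ∷ᵥ ρ)

module Collapse {Pr : Set} (𝔓 : PredStruct Pr) where
  open PredStruct 𝔓
  private
    module PO = IsPartialOrder ≤-po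

  _≤ᴮ_ : Ω × W → Ω × W → Set
  (a , v) ≤ᴮ (b , w) = (a ≤ b) × (v ≡ w)

  ≤ᴮ-po : IsPartialOrder _≡_ _≤ᴮ_
  ≤ᴮ-po = record
    { isPreorder = record
      { isEquivalence = isEquivalence
      ; reflexive = λ { refl → PO.refl , refl }
      ; trans = λ { (p , refl) (q , refl) → PO.trans p q , refl }
      }
    ; antisym = λ { (p , refl) (q , _) → cong (_, _) (PO.antisym p q) }
    }

  collapse : BiStruct Pr
  collapse = record
    { Wd     = Ω × W
    ; _≤_    = _≤ᴮ_
    ; ≤-po   = ≤ᴮ-po
    ; Sets   = 𝒲
    ; mem    = λ V av → ext V (proj₁ av) (proj₂ av)
    ; mem-up = λ { (p , refl) x → ext-mono p x }
    ; val    = ι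
    ; R      = λ av bw → (proj₁ av ≡ proj₁ bw) × R (proj₁ av) (proj₂ av) (proj₂ bw)
    }

  _ᴮ : 𝒲 → BiStruct.Sets collapse
  V ᴮ = V

module Submission where

open import Defs
open import Data.Nat using (ℕ)
open import Data.Fin using (Fin)
open import Data.Product using (_,_)
open import Function.Bundles using (_⇔_; mk⇔)
open import Relation.Binary.PropositionalEquality using (refl)

-- In the collapse, (a , v) ≤ (b , w) forces w = v and (a , v) R (b , w) forces
-- b = a, so every quantifier over the collapse ranges over exactly the states
-- b ≥ a (and the R^b-neighbours of v) quantified over in 𝔓; the sets of the
-- collapse are indexed by 𝒲 itself, so ∀ ranges over the same class.
-- Induction on A, generalised over the assignment ρ because ∀ extends it.

module _ {Pr : Set} (𝔓 : PredStruct Pr) where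
  open PredStruct 𝔓
  open Collapse 𝔓
  private
    module B = BiStruct collapse

  collapse-sat→sat : ∀ {n} (A : Formula Pr n) (ρ : Fin n → 𝒲) a v →
                     B.sat (a , v) A ρ → sat a v A ρ
  sat→collapse-sat : ∀ {n} (A : Formula Pr n) (ρ : Fin n → 𝒲) a v →
                     sat a v A ρ → B.sat (a , v) A ρ

  collapse-sat→sat (prop P) ρ a v h = h
  collapse-sat→sat (var i)  ρ a v h = h
  collapse-sat→sat (A ⇒ C)  ρ a v h b a≤b hA =
    collapse-sat→sat C ρ b v (h (b , v) (a≤b , refl) (sat→collapse-sat A ρ b v hA))
  collapse-sat→sat (□ A)    ρ a v h b w a≤b vRw =
    collapse-sat→sat A ρ b w (h (b , v) (b , w) (a≤b , refl) (refl , vRw))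
  collapse-sat→sat (■ A)    ρ a v h b u a≤b uRv =
    collapse-sat→sat A ρ b u (h (b , v) (b , u) (a≤b , refl) (refl , uRv))
  collapse-sat→sat (∀' A)   ρ a v h b a≤b V =
    collapse-sat→sat A (V ∷ᵥ ρ) b v (h (b , v) (a≤b , refl) V)

  sat→collapse-sat (prop P) ρ a v h = h
  sat→collapse-sat (var i)  ρ a v h = h
  sat→collapse-sat (A ⇒ C)  ρ a v h (b , .v) (a≤b , refl) hA =
    sat→collapse-sat C ρ b v (h b a≤b (collapse-sat→sat A ρ b v hA))
  sat→collapse-sat (□ A)    ρ a v h (b , .v) (.b , w) (a≤b , refl) (refl , vRw) =
    sat→collapse-sat A ρ b w (h b w a≤b vRw)
  sat→collapse-sat (■ A)    ρ a v h (b , .v) (.b , u) (a≤b , refl) (refl , uRv) =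
    sat→collapse-sat A ρ b u (h b u a≤b uRv)
  sat→collapse-sat (∀' A)   ρ a v h (b , .v) (a≤b , refl) V =
    sat→collapse-sat A (V ∷ᵥ ρ) b v (h b a≤b V)

  collapse-sat⇔sat : ∀ {n} (A : Formula Pr n) (ρ : Fin n → 𝒲) a v →
                     B.sat (a , v) A ρ ⇔ sat a v A ρ
  collapse-sat⇔sat A ρ a v = mk⇔ (collapse-sat→sat A ρ a v) (sat→collapse-sat A ρ a v)

proposition3p8 : (Pr : Set) (𝔓 : PredStruct Pr) (n : ℕ) (A : Formula Pr n)
    (Vs : Fin n → PredStruct.𝒲 𝔓) (a : PredStruct.Ω 𝔓) (v : PredStruct.W 𝔓) →
    BiStruct.sat (Collapse.collapse 𝔓) (a , v) A (λ i → Collapse._ᴮ 𝔓 (Vs i))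
    ⇔ PredStruct.sat 𝔓 a v A Vs
proposition3p8 Pr 𝔓 n A Vs a v = collapse-sat⇔sat 𝔓 A Vs a v
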